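{- The map $\lambda\mapsto\pi(\lambda)$, from integer partitions to permutations, is injective.
   Context: For a partition $\lambda$ (Young diagram with rows indexed top to bottom and columns left to right), the antidiagonal filling labels the square in row $r$, column $c$ by $r+c-1$, and the reading word $\mathrm{read}(\lambda)$ concatenates the rows' entries from the bottom row to the top row, each row read left to right. This word $i_1\cdots i_m$ is a reduced word, and $\pi(\lambda)$ denotes the permutation $\sigma_{i_1}\cdots\sigma_{i_m}$ (with $\sigma_i$ the adjacent transposition of $i,i+1$), regarded as a permutation of the positive integers fixing all but finitely many of them (equivalently, as an element of $\mathfrak{S}_N$ for $N$ one more than the largest letter). For example, $\pi(7,4,4,2,1)=65472381$. -}

module Defs where

open import Data.Nat using (ℕ; zero; suc; _+_; _≤_; _≥_; _≟_)
open import Data.List using (List; []; _∷_; _++_; map; reverse; upTo; foldr)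
open import Data.List.Relation.Unary.All using (All)
open import Data.List.Relation.Unary.Linked using (Linked)
open import Relation.Nullary using (yes; no)
open import Function using (_∘_; id)

IsPartition : List ℕ → Set
IsPartition λs = Linked _≥_ λs × All (1 ≤_) λs
  where open import Data.Product using (_×_)

-- Row r (1-indexed) of length k in the antidiagonal filling reads
-- r, r+1, ..., r+k-1 from left to right.
rowWord : ℕ → ℕ → List ℕ
rowWord r k = map (r +_) (upTo k)

rowsFrom : ℕ → List ℕ → List (List ℕ)
rowsFrom r []       = []
rowsFrom r (k ∷ ks) = rowWord r k ∷ rowsFrom (suc r) ks

read : List ℕ → List ℕ
read λs = foldr _++_ [] (reverse (rowsFrom 1 λs))

-- adjacent transposition σ_i of i and i+1, as a map on ℕ
-- (permutations of the positive integers; 0 is always fixed)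
σ : ℕ → ℕ → ℕ
σ i x with x ≟ i
... | yes _ = suc i
... | no _ with x ≟ suc i
...   | yes _ = i
...   | no _  = x

wordPerm : List ℕ → ℕ → ℕ
wordPerm = foldr (λ i f → σ i ∘ f) id

π : List ℕ → ℕ → ℕ
π λs = wordPerm (read λs)

-- Read as a function, π λ applies the top row first, then the rows below it.
-- Row r of length k sends r + k down to r, and all later rows only move
-- numbers larger than r, so π λ (1 + λ₁) = 1; injectivity of π λ then pins
-- down λ₁. Cancelling the (bijective) first row leaves the same situation for
-- the remaining rows, starting at row 2, and induction recovers every part.

module Submission where

open import Defs
open import Data.Nat using (ℕ; zero; suc; _+_; _≤_; _<_; _≟_)
open import Data.Nat.Properties
  using (+-suc; +-identityʳ; +-cancelˡ-≡; m+1+n≢m; 1+n≢n; <⇒≢; n<1+n; <-trans)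
open import Data.List using (List; []; _∷_; _++_; [_]; map; reverse; concat; applyUpTo)
open import Data.List.Properties
  using (unfold-reverse; concat-++; concat-[_]; map-applyUpTo)
open import Data.List.Relation.Unary.All using (All; []; _∷_)
open import Data.Product using (proj₂)
open import Data.Empty using (⊥-elim)
open import Relation.Nullary using (Dec; yes; no; ¬_)
open import Relation.Binary.PropositionalEquality
  using (_≡_; _≢_; _≗_; refl; sym; trans; cong; cong₂; module ≡-Reasoning)
open import Function using (_∘_)

open ≡-Reasoning

σ-self : ∀ i → σ i i ≡ suc i
σ-self i with i ≟ i
... | yes _ = refl
... | no i≢i = ⊥-elim (i≢i refl)

σ-suc : ∀ i → σ i (suc i) ≡ i
σ-suc i with suc i ≟ i
... | yes 1+i≡i = ⊥-elim (1+n≢n 1+i≡i)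
... | no _ with suc i ≟ suc i
...   | yes _ = refl
...   | no 1+i≢1+i = ⊥-elim (1+i≢1+i refl)

σ-fix : ∀ {i x} → x ≢ i → x ≢ suc i → σ i x ≡ x
σ-fix {i} {x} x≢i x≢1+i with x ≟ i
... | yes x≡i = ⊥-elim (x≢i x≡i)
... | no _ with x ≟ suc i
...   | yes x≡1+i = ⊥-elim (x≢1+i x≡1+i)
...   | no _ = refl

σ-involutive : ∀ i x → σ i (σ i x) ≡ x
σ-involutive i x = by-cases (x ≟ i) (x ≟ suc i)
  where
  by-cases : Dec (x ≡ i) → Dec (x ≡ suc i) → σ i (σ i x) ≡ x
  by-cases (yes refl) _          = trans (cong (σ i) (σ-self i)) (σ-suc i)
  by-cases (no _)     (yes refl) = trans (cong (σ i) (σ-suc i)) (σ-self i)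
  by-cases (no x≢i)   (no x≢1+i) = trans (cong (σ i) (σ-fix x≢i x≢1+i)) (σ-fix x≢i x≢1+i)

wordPerm-++ : ∀ xs ys → wordPerm (xs ++ ys) ≗ wordPerm xs ∘ wordPerm ys
wordPerm-++ []       ys x = refl
wordPerm-++ (i ∷ xs) ys x = cong (σ i) (wordPerm-++ xs ys x)

wordPerm-injective : ∀ xs {a b} → wordPerm xs a ≡ wordPerm xs b → a ≡ b
wordPerm-injective []       eq = eq
wordPerm-injective (i ∷ xs) eq = wordPerm-injective xs
  (trans (sym (σ-involutive i _)) (trans (cong (σ i) eq) (σ-involutive i _)))

wordPerm-reverse-inverseʳ : ∀ xs → wordPerm xs ∘ wordPerm (reverse xs) ≗ (λ y → y)
wordPerm-reverse-inverseʳ []       y = refl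
wordPerm-reverse-inverseʳ (i ∷ xs) y = begin
  σ i (wordPerm xs (wordPerm (reverse (i ∷ xs)) y))
    ≡⟨ cong (λ w → σ i (wordPerm xs (wordPerm w y))) (unfold-reverse i xs) ⟩
  σ i (wordPerm xs (wordPerm (reverse xs ++ [ i ]) y))
    ≡⟨ cong (σ i ∘ wordPerm xs) (wordPerm-++ (reverse xs) [ i ] y) ⟩
  σ i (wordPerm xs (wordPerm (reverse xs) (σ i y)))
    ≡⟨ cong (σ i) (wordPerm-reverse-inverseʳ xs (σ i y)) ⟩
  σ i (σ i y)
    ≡⟨ σ-involutive i y ⟩
  y ∎

applyUpTo-cong : ∀ {A : Set} {f g : ℕ → A} → f ≗ g → ∀ n → applyUpTo f n ≡ applyUpTo g n
applyUpTo-cong f≗g zero    = refl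
applyUpTo-cong f≗g (suc n) = cong₂ _∷_ (f≗g 0) (applyUpTo-cong (f≗g ∘ suc) n)

rowWord-suc : ∀ r k → rowWord r (suc k) ≡ r ∷ rowWord (suc r) k
rowWord-suc r k = begin
  map (r +_) (applyUpTo (λ i → i) (suc k))
    ≡⟨ map-applyUpTo (λ i → i) (r +_) (suc k) ⟩
  r + 0 ∷ applyUpTo (λ i → r + suc i) k
    ≡⟨ cong₂ _∷_ (+-identityʳ r) (applyUpTo-cong (+-suc r) k) ⟩
  r ∷ applyUpTo (suc r +_) k
    ≡⟨ cong (r ∷_) (sym (map-applyUpTo (λ i → i) (suc r +_) k)) ⟩
  r ∷ rowWord (suc r) k ∎

rowWord-top : ∀ r k → wordPerm (rowWord r k) (r + k) ≡ r
rowWord-top r zero    = +-identityʳ r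
rowWord-top r (suc k) = begin
  wordPerm (rowWord r (suc k)) (r + suc k)  ≡⟨ cong₂ wordPerm (rowWord-suc r k) (+-suc r k) ⟩
  σ r (wordPerm (rowWord (suc r) k) (suc r + k)) ≡⟨ cong (σ r) (rowWord-top (suc r) k) ⟩
  σ r (suc r)                                ≡⟨ σ-suc r ⟩
  r                                          ∎

rowWord-fix-< : ∀ r k {y} → y < r → wordPerm (rowWord r k) y ≡ y
rowWord-fix-< r zero    y<r = refl
rowWord-fix-< r (suc k) {y} y<r = begin
  wordPerm (rowWord r (suc k)) y          ≡⟨ cong (λ w → wordPerm w y) (rowWord-suc r k) ⟩
  σ r (wordPerm (rowWord (suc r) k) y)    ≡⟨ cong (σ r) (rowWord-fix-< (suc r) k y<1+r) ⟩
  σ r y                                   ≡⟨ σ-fix (<⇒≢ y<r) (<⇒≢ y<1+r) ⟩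
  y                                       ∎
  where y<1+r = <-trans y<r (n<1+n r)

-- π λs is definitionally πFrom 1 λs.
πFrom : ℕ → List ℕ → ℕ → ℕ
πFrom r λs = wordPerm (concat (reverse (rowsFrom r λs)))

πFrom-∷ : ∀ r k ks → πFrom r (k ∷ ks) ≗ πFrom (suc r) ks ∘ wordPerm (rowWord r k)
πFrom-∷ r k ks x = begin
  wordPerm (concat (reverse (rowWord r k ∷ rows))) x
    ≡⟨ cong (λ w → wordPerm (concat w) x) (unfold-reverse (rowWord r k) rows) ⟩
  wordPerm (concat (reverse rows ++ [ rowWord r k ])) x
    ≡⟨ cong (λ w → wordPerm w x) (sym (concat-++ (reverse rows) [ rowWord r k ])) ⟩
  wordPerm (concat (reverse rows) ++ concat [ rowWord r k ]) x
    ≡⟨ cong (λ w → wordPerm (concat (reverse rows) ++ w) x) (concat-[ rowWord r k ]) ⟩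
  wordPerm (concat (reverse rows) ++ rowWord r k) x
    ≡⟨ wordPerm-++ (concat (reverse rows)) (rowWord r k) x ⟩
  πFrom (suc r) ks (wordPerm (rowWord r k) x) ∎
  where rows = rowsFrom (suc r) ks

πFrom-fix-< : ∀ r ks {y} → y < r → πFrom r ks y ≡ y
πFrom-fix-< r []       y<r = refl
πFrom-fix-< r (k ∷ ks) {y} y<r = begin
  πFrom r (k ∷ ks) y                       ≡⟨ πFrom-∷ r k ks y ⟩
  πFrom (suc r) ks (wordPerm (rowWord r k) y) ≡⟨ cong (πFrom (suc r) ks) (rowWord-fix-< r k y<r) ⟩
  πFrom (suc r) ks y                       ≡⟨ πFrom-fix-< (suc r) ks (<-trans y<r (n<1+n r)) ⟩
  y                                        ∎

πFrom-top : ∀ r k ks → πFrom r (k ∷ ks) (r + k) ≡ r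
πFrom-top r k ks = begin
  πFrom r (k ∷ ks) (r + k)                        ≡⟨ πFrom-∷ r k ks (r + k) ⟩
  πFrom (suc r) ks (wordPerm (rowWord r k) (r + k)) ≡⟨ cong (πFrom (suc r) ks) (rowWord-top r k) ⟩
  πFrom (suc r) ks r                              ≡⟨ πFrom-fix-< (suc r) ks (n<1+n r) ⟩
  r                                               ∎

πFrom-cancel-∷ : ∀ r k ks js → πFrom r (k ∷ ks) ≗ πFrom r (k ∷ js) →
  πFrom (suc r) ks ≗ πFrom (suc r) js
πFrom-cancel-∷ r k ks js eq y = begin
  πFrom (suc r) ks y         ≡⟨ cong (πFrom (suc r) ks) (sym (undo y)) ⟩
  πFrom (suc r) ks (row y′)  ≡⟨ sym (πFrom-∷ r k ks y′) ⟩
  πFrom r (k ∷ ks) y′        ≡⟨ eq y′ ⟩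
  πFrom r (k ∷ js) y′        ≡⟨ πFrom-∷ r k js y′ ⟩
  πFrom (suc r) js (row y′)  ≡⟨ cong (πFrom (suc r) js) (undo y) ⟩
  πFrom (suc r) js y         ∎
  where
  row  = wordPerm (rowWord r k)
  y′   = wordPerm (reverse (rowWord r k)) y
  undo = wordPerm-reverse-inverseʳ (rowWord r k)

πFrom-[]≉∷ : ∀ r {k} ks → 1 ≤ k → ¬ (πFrom r [] ≗ πFrom r (k ∷ ks))
πFrom-[]≉∷ r {suc k} ks _ eq = m+1+n≢m r (trans (eq (r + suc k)) (πFrom-top r (suc k) ks))

πFrom-head : ∀ r k ks j js → πFrom r (k ∷ ks) ≗ πFrom r (j ∷ js) → k ≡ j
πFrom-head r k ks j js eq = sym (+-cancelˡ-≡ r j k (wordPerm-injective (concat (reverse (rowsFrom r (k ∷ ks))))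
  (begin
    πFrom r (k ∷ ks) (r + j) ≡⟨ eq (r + j) ⟩
    πFrom r (j ∷ js) (r + j) ≡⟨ πFrom-top r j js ⟩
    r                        ≡⟨ sym (πFrom-top r k ks) ⟩
    πFrom r (k ∷ ks) (r + k) ∎)))

πFrom-injective : ∀ r λs μs → All (1 ≤_) λs → All (1 ≤_) μs →
  πFrom r λs ≗ πFrom r μs → λs ≡ μs
πFrom-injective r []       []       _         _         _  = refl
πFrom-injective r []       (j ∷ js) _         (1≤j ∷ _) eq = ⊥-elim (πFrom-[]≉∷ r js 1≤j eq)
πFrom-injective r (k ∷ ks) []       (1≤k ∷ _) _         eq = ⊥-elim (πFrom-[]≉∷ r ks 1≤k (sym ∘ eq))
πFrom-injective r (k ∷ ks) (j ∷ js) (_ ∷ ks-pos) (_ ∷ js-pos) eq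
  with refl ← πFrom-head r k ks j js eq =
    cong (k ∷_) (πFrom-injective (suc r) ks js ks-pos js-pos (πFrom-cancel-∷ r k ks js eq))

lemma5p26 : (λs μs : List ℕ) → IsPartition λs → IsPartition μs →
    (∀ n → π λs n ≡ π μs n) → λs ≡ μs
lemma5p26 λs μs λ-partition μ-partition =
  πFrom-injective 1 λs μs (proj₂ λ-partition) (proj₂ μ-partition)
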